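{- In the algebra $\mathcal P\otimes\bigwedge^\bullet(\mathfrak p^*)$, the element $\psi_{KM}=-\frac{1}{2(p+q-1)}h(\varphi_{KM})$ equals \[ \psi_{KM}=\Big(\frac{ -\sqrt2}{4\pi}\Big)^q\frac{ -1}{2(q-1)!}\sum_{\alpha_1,\dots,\alpha_{q-1}=1}^p z_{\alpha_1}\cdots z_{\alpha_{q-1}}\det\begin{pmatrix}z_{p+1}&\cdots&z_{p+q}\\ \omega_{\alpha_1,p+1}&\cdots&\omega_{\alpha_1,p+q}\\ \vdots&&\vdots\\ \omega_{\alpha_{q-1},p+1}&\cdots&\omega_{\alpha_{q-1},p+q}\end{pmatrix}, \] where the determinant in this non-commutative algebra is defined inductively by expansion along the first row.
   Context: Let $p,q\ge1$. $\mathcal P=\mathbb C[z_1,\dots,z_{p+q}]$ (variables $z_\alpha$, $1\le\alpha\le p$, and $z_\mu$, $p+1\le\mu\le p+q$). $\mathfrak p\cong M_{p,q}(\mathbb R)$ with basis $X_{\alpha\mu}$ ($1\le\alpha\le p<\mu\le p+q$) and dual basis $\omega_{\alpha\mu}$; $\bigwedge^\bullet(\mathfrak p^*)$ its exterior algebra, and $\mathcal P\otimes\bigwedge^\bullet(\mathfrak p^*)$ the tensor product algebra (polynomials commute with forms). $A^*_{\alpha\mu}$ denotes interior multiplication by $X_{\alpha\mu}$ (the antiderivation with $A^*_{\alpha\mu}(\omega_{\alpha'\mu'})=\delta_{\alpha\alpha'}\delta_{\mu\mu'}$). Define $\varphi_{KM}=\big(\frac{ -\sqrt2}{4\pi}\big)^q\sum_{\alpha_1,\dots,\alpha_q=1}^p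 z_{\alpha_1}\cdots z_{\alpha_q}\otimes\omega_{\alpha_1,p+1}\wedge\cdots\wedge\omega_{\alpha_q,p+q}$ and the operator $h=\sum_{\alpha,\mu}z_\mu\frac{\partial}{\partial z_\alpha}\otimes A^*_{\alpha\mu}$. (This is the Kudla–Millson form in the Fock model of the Weil representation.) The determinant of a matrix whose first row has polynomial entries and whose other rows consist of 1-forms is $\sum_{j=1}^q(-1)^{j+1}a_{1j}\det(\text{minor}_{1j})$, recursively, with products of forms being wedge products in order. -}

module Defs where

open import Level using (Level)
open import Algebra.Bundles using (CommutativeRing)
open import Data.Nat using (ℕ; zero; suc; _∸_)
import Data.Nat as ℕ
import Data.Nat.Properties as ℕP
open import Data.Bool using (Bool; true; false; if_then_else_; _∧_)
open import Data.Fin using (Fin; zero; suc; toℕ; _↑ˡ_; _↑ʳ_; combine; punchIn)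
import Data.Fin.Properties as FinP
open import Data.List using (allFin; List; []; _∷_; _++_; map; concat; concatMap; foldr; length; filter; [_])
open import Data.Bool.ListAction using (any)
open import Data.Vec using (Vec; replicate; lookup; zipWith; _[_]≔_)
import Data.Vec as V
open import Data.Vec.Properties using (≡-dec)
import Data.Bool.Properties as BoolP
open import Data.Product using (_×_; _,_)
open import Relation.Nullary.Decidable using (⌊_⌋)

-- Coordinates of P ⊗ Λ(p*) over a commutative coefficient ring R.
module KM {c ℓ : Level} (R : CommutativeRing c ℓ) where
  open CommutativeRing R renaming (Carrier to K) hiding (zero)

  nat : ℕ → K
  nat zero = 0#
  nat (suc n) = 1# + nat n

  sgn : ℕ → K
  sgn zero = 1#
  sgn (suc n) = - sgn n

  pow : K → ℕ → K
  pow x zero = 1#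
  pow x (suc n) = x * pow x n

  module _ (p q : ℕ) where
    -- variables z_1..z_{p+q}: z_α = index α ↑ˡ q (α : Fin p),
    -- z_{p+μ} = index p ↑ʳ μ (μ : Fin q).
    -- basis of p* : ω_{α,p+μ} indexed by combine α μ : Fin (p * q).
    Mono : Set
    Mono = Vec ℕ (p ℕ.+ q)

    Word : Set
    Word = List (Fin (p ℕ.* q))

    -- a term  c · z^m ⊗ ω_{w1} ∧ ... ∧ ω_{wk}
    record Term : Set c where
      constructor tm
      field
        coef : K
        mono : Mono
        word : Word
    open Term

    -- an element of P ⊗ Λ(p*) represented as a finite formal sum of terms
    Elem : Set c
    Elem = List Term

    zeroMono : Mono
    zeroMono = replicate _ 0

    one : Elem
    one = [ tm 1# zeroMono [] ]

    zvar : Fin (p ℕ.+ q) → Elem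
    zvar i = [ tm 1# (zeroMono [ i ]≔ 1) [] ]

    zα : Fin p → Elem
    zα α = zvar (α ↑ˡ q)

    zμ : Fin q → Elem
    zμ μ = zvar (p ↑ʳ μ)

    ω : Fin p → Fin q → Elem
    ω α μ = [ tm 1# zeroMono [ combine α μ ] ]

    scale : K → Elem → Elem
    scale r = map (λ t → tm (r * coef t) (mono t) (word t))

    -- product in the algebra (polynomials commute with forms; forms wedge in order)
    _·_ : Elem → Elem → Elem
    f · g = concatMap (λ s → map (λ t → tm (coef s * coef t) (zipWith ℕ._+_ (mono s) (mono t)) (word s ++ word t)) g) f

    sumL : List Elem → Elem
    sumL = concat

    prodL : List Elem → Elem
    prodL = foldr _·_ one

    ∂ : Fin (p ℕ.+ q) → Elem → Elem
    ∂ i = map (λ t → tm (coef t * nat (lookup (mono t) i)) (mono t [ i ]≔ (lookup (mono t) i ∸ 1)) (word t))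

    -- interior multiplication by the basis vector b, as an antiderivation on words
    ιw : Fin (p ℕ.* q) → Word → List (K × Word)
    ιw b [] = []
    ιw b (x ∷ w) = (if ⌊ x FinP.≟ b ⌋ then [ (1# , w) ] else [])
                   ++ map (λ { (r , w') → (- r , x ∷ w') }) (ιw b w)

    A* : Fin p → Fin q → Elem → Elem
    A* α μ = concatMap (λ t → map (λ { (r , w') → tm (coef t * r) (mono t) w' }) (ιw (combine α μ) (word t)))

    h : Elem → Elem
    h f = sumL (concatMap (λ α → map (λ μ → zμ μ · ∂ (α ↑ˡ q) (A* α μ f)) (allFin q)) (allFin p))

    tuples : (k : ℕ) → List (Vec (Fin p) k)
    tuples zero = [ V.[] ]
    tuples (suc k) = concatMap (λ a → map (a V.∷_) (tuples k)) (allFin p)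

    -- φ_KM, with the constant -√2/(4π) replaced by a general κ ∈ R
    φKM : K → Elem
    φKM κ = scale (pow κ q)
      (sumL (map (λ a → prodL (map (λ j → zα (lookup a j)) (allFin q))
                        · prodL (map (λ j → ω (lookup a j) j) (allFin q)))
                 (tuples q)))

    det : (n : ℕ) → (Fin n → Fin n → Elem) → Elem
    det zero M = one
    det (suc n) M = sumL (map (λ j → scale (sgn (toℕ j)) (M zero j · det n (λ r c' → M (suc r) (punchIn j c'))))
                              (allFin (suc n)))

    -- coordinates in the basis z^m ⊗ ω_S (S ⊆ basis, wedge in increasing index order)
    support : Word → Vec Bool (p ℕ.* q)
    support = foldr (λ x s → s [ x ]≔ true) (replicate _ false)

    memB : Fin (p ℕ.* q) → Word → Bool
    memB x = any (λ y → ⌊ x FinP.≟ y ⌋)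

    -- sign of reordering a word to increasing order (0 if a letter repeats)
    sgnW : Word → K
    sgnW [] = 1#
    sgnW (x ∷ w) = (if memB x w then 0# else sgn (length (filter (FinP._<? x) w))) * sgnW w

    coeff : Elem → Mono → Vec Bool (p ℕ.* q) → K
    coeff f m S = foldr (λ t acc → (if ⌊ ≡-dec ℕP._≟_ (mono t) m ⌋ ∧ ⌊ ≡-dec BoolP._≟_ (support (word t)) S ⌋
                                    then coef t * sgnW (word t) else 0#) + acc) 0# f

    _≈ᴱ_ : Elem → Elem → Set ℓ
    f ≈ᴱ g = ∀ m S → coeff f m S ≈ coeff g m S

  -- right-hand side of Lemma 4.1, with κ in place of -√2/(4π) and
  -- v in place of 1/(2 (q-1)!).  (q = 0 is excluded by hypothesis.)
  rhsKM : (p q : ℕ) → K → K → Elem p q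
  rhsKM p zero κ v = []
  rhsKM p (suc n) κ v =
    scale p (suc n) (pow κ (suc n) * (- v))
      (sumL p (suc n) (map (λ a → _·_ p (suc n) (prodL p (suc n) (map (λ i → zα p (suc n) (lookup a i)) (allFin n)))
                                       (det p (suc n) (suc n) (M a)))
                        (tuples p (suc n) n)))
    where
      M : Vec (Fin p) n → Fin (suc n) → Fin (suc n) → Elem p (suc n)
      M a zero j = zμ p (suc n) j
      M a (suc i) j = ω p (suc n) (lookup a i) j

  -- ψ_KM = -1/(2(p+q-1)) h(φ_KM), with u in place of 1/(2(p+q-1))
  ψKM : (p q : ℕ) → K → K → Elem p q
  ψKM p q κ u = scale p q (- u) (h p q (φKM p q κ))

module Submission where

-- Both sides are compared coefficientwise in the basis z^m ⊗ ω_S.  In h(φ_KM), with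
-- φ_KM = κ^q Σ_a z_a ω_{a_1,p+1} ∧ ⋯ ∧ ω_{a_q,p+q}, the interior product A*_{αμ} only meets the
-- factor ω_{a_j,p+j}, i.e. (α, μ) = (a_j, p+j), and removes it with sign (-1)^(j-1); writing a as b with
-- x inserted at position j, the derivative ∂/∂z_x contributes the exponent of z_x in z_x z_b, and
-- summing over x gives p + (q - 1).  On the other side, expanding the determinant along its first
-- row leaves (q-1)×(q-1) determinants of forms multiplied by the symmetric z_b, and each of them
-- contributes (q-1)! copies of its diagonal product: moving a form across k others costs exactly
-- the cofactor sign (-1)^k.  So both sides are scalar multiples of the same sum, with scalars
-- -κ^q u (p+q-1) and -κ^q v (q-1)!, and these agree since 2u(p+q-1) = 1 = 2v(q-1)!.

open import Algebra.Bundles using (CommutativeRing; CommutativeMonoid)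
import Algebra.Properties.CommutativeSemigroup
import Algebra.Solver.CommutativeMonoid
open import Data.Bool using (Bool; true; false; if_then_else_; _∧_; _∨_)
import Data.Bool.Properties as Bool
open import Data.Empty using (⊥-elim)
open import Data.Fin using (Fin; zero; suc; toℕ; punchIn; _<_; _↑ˡ_; _↑ʳ_; combine)
import Data.Fin.Properties as Fin
open import Data.List using (List; []; _∷_; _++_; [_]; map; concat; concatMap; foldr; tabulate; allFin; length; filter)
import Data.List.Properties as List
open import Data.List.Relation.Binary.Permutation.Propositional as ↭ using (_↭_)
open import Data.List.Relation.Binary.Permutation.Propositional.Properties using (++⁺ˡ; ↭-length; filter-↭)
open import Data.Nat using (ℕ; zero; suc; _!)
import Data.Nat as ℕ
import Data.Nat.Properties as ℕ
open import Data.Product using (_×_; _,_; proj₁; proj₂)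
open import Data.Vec using (Vec; []; _∷_; _[_]≔_; lookup; zipWith; replicate; insertAt)
import Data.Vec.Properties as Vec
open import Function using (_∘_)
open import Level using (0ℓ)
open import Relation.Binary.Definitions using (tri<; tri≈; tri>)
open import Relation.Binary.PropositionalEquality as ≡ using (_≡_; _≢_)
open import Relation.Nullary using (yes; no)
open import Relation.Nullary.Decidable using (⌊_⌋)

open import Defs

module _ {a} {A : Set a} where

  map-allFin-suc : ∀ {n} (F : Fin (suc n) → A) → map F (allFin (suc n)) ≡ F zero ∷ map (F ∘ suc) (allFin n)
  map-allFin-suc F = ≡.cong (F zero ∷_) (≡.trans (List.map-tabulate suc F) (≡.sym (List.map-tabulate (λ i → i) (F ∘ suc))))

  moveToFront-↭ : ∀ n (g : Fin (suc n) → A) k → g k ∷ tabulate (g ∘ punchIn k) ↭ tabulate g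
  moveToFront-↭ n       g zero    = ↭.refl
  moveToFront-↭ (suc n) g (suc k) = ↭.trans (↭.swap (g (suc k)) (g zero) ↭.refl) (↭.prep (g zero) (moveToFront-↭ n (g ∘ suc) k))

monomialMonoid : ℕ → CommutativeMonoid 0ℓ 0ℓ
monomialMonoid N = record
  { Carrier             = Vec ℕ N
  ; _≈_                 = _≡_
  ; _∙_                 = zipWith ℕ._+_
  ; ε                   = replicate N 0
  ; isCommutativeMonoid = record
    { isMonoid = record
      { isSemigroup = record
        { isMagma = record { isEquivalence = ≡.isEquivalence ; ∙-cong = ≡.cong₂ (zipWith ℕ._+_) }
        ; assoc   = Vec.zipWith-assoc ℕ.+-assoc }
      ; identity = Vec.zipWith-identityˡ ℕ.+-identityˡ , Vec.zipWith-identityʳ ℕ.+-identityʳ }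
    ; comm = Vec.zipWith-comm ℕ.+-comm }
  }

zipWith-+-unit : ∀ {N} (i : Fin N) m → zipWith ℕ._+_ (replicate N 0 [ i ]≔ 1) m ≡ m [ i ]≔ suc (lookup m i)
zipWith-+-unit zero    (a ∷ m) = ≡.cong (suc a ∷_) (Vec.zipWith-identityˡ ℕ.+-identityˡ m)
zipWith-+-unit (suc i) (a ∷ m) = ≡.cong (a ∷_) (zipWith-+-unit i m)

module Arithmetic {c ℓ} (R : CommutativeRing c ℓ) where
  open CommutativeRing R renaming (Carrier to K) hiding (zero)
  open import Algebra.Properties.Ring ring using (-‿distribˡ-*; -‿distribʳ-*; -‿involutive)
  open import Algebra.Properties.CommutativeSemigroup +-commutativeSemigroup using (interchange)
  module * = Algebra.Properties.CommutativeSemigroup *-commutativeSemigroup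
  open import Relation.Binary.Reasoning.Setoid setoid
  open KM R

  ∑ : ∀ {a} {A : Set a} → List A → (A → K) → K
  ∑ xs f = foldr (λ x acc → f x + acc) 0# xs

  -- Like ∑[ i < n ] in the standard library, ∑[ x ← xs ] binds tighter than _+_ and _*_.
  syntax ∑ xs (λ x → e) = ∑[ x ← xs ] e

  module _ {a} {A : Set a} where

    ∑-cong : ∀ xs {f g : A → K} → (∀ x → f x ≈ g x) → ∑ xs f ≈ ∑ xs g
    ∑-cong []       f≈g = refl
    ∑-cong (x ∷ xs) f≈g = +-cong (f≈g x) (∑-cong xs f≈g)

    ∑-zero : ∀ xs {f : A → K} → (∀ x → f x ≈ 0#) → ∑ xs f ≈ 0#
    ∑-zero []       f≈0 = refl
    ∑-zero (x ∷ xs) f≈0 = trans (+-cong (f≈0 x) (∑-zero xs f≈0)) (+-identityˡ 0#)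

    ∑-++ : ∀ xs ys (f : A → K) → ∑ (xs ++ ys) f ≈ ∑ xs f + ∑ ys f
    ∑-++ []       ys f = sym (+-identityˡ _)
    ∑-++ (x ∷ xs) ys f = trans (+-congˡ (∑-++ xs ys f)) (sym (+-assoc _ _ _))

    ∑-distrib-+ : ∀ xs (f g : A → K) → ∑[ x ← xs ] (f x + g x) ≈ ∑ xs f + ∑ xs g
    ∑-distrib-+ []       f g = sym (+-identityˡ 0#)
    ∑-distrib-+ (x ∷ xs) f g = trans (+-congˡ (∑-distrib-+ xs f g)) (interchange _ _ _ _)

    *-distribˡ-∑ : ∀ k xs (f : A → K) → k * ∑ xs f ≈ ∑[ x ← xs ] (k * f x)
    *-distribˡ-∑ k []       f = zeroʳ k
    *-distribˡ-∑ k (x ∷ xs) f = trans (distribˡ k _ _) (+-congˡ (*-distribˡ-∑ k xs f))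

    *-distribʳ-∑ : ∀ k xs (f : A → K) → ∑ xs f * k ≈ ∑[ x ← xs ] (f x * k)
    *-distribʳ-∑ k xs f = trans (*-comm _ k) (trans (*-distribˡ-∑ k xs f) (∑-cong xs (λ x → *-comm k (f x))))

  module _ {a b} {A : Set a} {B : Set b} where

    ∑-map : ∀ (g : A → B) xs (f : B → K) → ∑ (map g xs) f ≡ ∑ xs (f ∘ g)
    ∑-map g []       f = ≡.refl
    ∑-map g (x ∷ xs) f = ≡.cong (f (g x) +_) (∑-map g xs f)

    ∑-comm : ∀ xs ys (f : A → B → K) → ∑[ x ← xs ] ∑[ y ← ys ] f x y ≈ ∑[ y ← ys ] ∑[ x ← xs ] f x y
    ∑-comm []       ys f = sym (∑-zero ys (λ _ → refl))
    ∑-comm (x ∷ xs) ys f = trans (+-congˡ (∑-comm xs ys f)) (sym (∑-distrib-+ ys (f x) _))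

    ∑-concatMap : ∀ (F : A → List B) xs (f : B → K) → ∑ (concatMap F xs) f ≈ ∑[ x ← xs ] ∑ (F x) f
    ∑-concatMap F []       f = refl
    ∑-concatMap F (x ∷ xs) f = trans (∑-++ (F x) _ f) (+-congˡ (∑-concatMap F xs f))

  ∑-concat : ∀ {a} {A : Set a} (xss : List (List A)) f → ∑ (concat xss) f ≈ ∑[ xs ← xss ] ∑ xs f
  ∑-concat []         f = refl
  ∑-concat (xs ∷ xss) f = trans (∑-++ xs _ f) (+-congˡ (∑-concat xss f))

  ∑-if : ∀ {a} {A : Set a} b (y : A) F → ∑ (if b then [ y ] else []) F ≈ (if b then F y else 0#)
  ∑-if true  y F = +-identityʳ _
  ∑-if false y F = refl

  ∑-allFin-suc : ∀ n (f : Fin (suc n) → K) → ∑ (allFin (suc n)) f ≡ f zero + ∑ (allFin n) (f ∘ suc)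
  ∑-allFin-suc n f = ≡.cong (f zero +_)
    (≡.trans (≡.cong (λ xs → ∑ xs f) (≡.sym (List.map-tabulate (λ i → i) suc))) (∑-map suc (allFin n) f))

  ∑-allFin-single : ∀ n (y : Fin n) (f : Fin n → K) → (∀ x → x ≢ y → f x ≈ 0#) → ∑ (allFin n) f ≈ f y
  ∑-allFin-single (suc n) zero f f≈0 = begin
    ∑ (allFin (suc n)) f                ≡⟨ ∑-allFin-suc n f ⟩
    f zero + ∑ (allFin n) (f ∘ suc)    ≈⟨ +-congˡ (∑-zero (allFin n) (λ x → f≈0 (suc x) (λ ()))) ⟩
    f zero + 0#                         ≈⟨ +-identityʳ _ ⟩
    f zero                              ∎
  ∑-allFin-single (suc n) (suc y) f f≈0 = begin
    ∑ (allFin (suc n)) f                ≡⟨ ∑-allFin-suc n f ⟩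
    f zero + ∑ (allFin n) (f ∘ suc)    ≈⟨ +-cong (f≈0 zero (λ ())) (∑-allFin-single n y (f ∘ suc) f∘suc≈0) ⟩
    0# + f (suc y)                      ≈⟨ +-identityˡ _ ⟩
    f (suc y)                           ∎
    where
    f∘suc≈0 : ∀ x → x ≢ y → f (suc x) ≈ 0#
    f∘suc≈0 x x≢y = f≈0 (suc x) (x≢y ∘ Fin.suc-injective)

  ∑-allFin-const : ∀ n k → ∑[ _ ← allFin n ] k ≈ nat n * k
  ∑-allFin-const zero    k = sym (zeroˡ k)
  ∑-allFin-const (suc n) k = begin
    ∑ (allFin (suc n)) (λ _ → k)  ≡⟨ ∑-allFin-suc n _ ⟩
    k + ∑ (allFin n) (λ _ → k)    ≈⟨ +-cong (sym (*-identityˡ k)) (∑-allFin-const n k) ⟩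
    1# * k + nat n * k             ≈⟨ distribʳ k 1# (nat n) ⟨
    (1# + nat n) * k               ∎

  nat-homo-+ : ∀ m n → nat (m ℕ.+ n) ≈ nat m + nat n
  nat-homo-+ zero    n = sym (+-identityˡ _)
  nat-homo-+ (suc m) n = trans (+-congˡ (nat-homo-+ m n)) (sym (+-assoc _ _ _))

  nat-homo-* : ∀ m n → nat (m ℕ.* n) ≈ nat m * nat n
  nat-homo-* zero    n = sym (zeroˡ _)
  nat-homo-* (suc m) n = begin
    nat (n ℕ.+ m ℕ.* n)           ≈⟨ nat-homo-+ n (m ℕ.* n) ⟩
    nat n + nat (m ℕ.* n)         ≈⟨ +-cong (sym (*-identityˡ _)) (nat-homo-* m n) ⟩
    1# * nat n + nat m * nat n    ≈⟨ distribʳ _ _ _ ⟨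
    (1# + nat m) * nat n          ∎

  sgn*sgn≈1 : ∀ n → sgn n * sgn n ≈ 1#
  sgn*sgn≈1 zero    = *-identityˡ 1#
  sgn*sgn≈1 (suc n) = begin
    - sgn n * - sgn n      ≈⟨ -‿distribˡ-* _ _ ⟨
    - (sgn n * - sgn n)    ≈⟨ -‿cong (-‿distribʳ-* _ _) ⟨
    - - (sgn n * sgn n)    ≈⟨ -‿involutive _ ⟩
    sgn n * sgn n          ≈⟨ sgn*sgn≈1 n ⟩
    1#                     ∎

  inverse-unique : ∀ {x a b} → x * a ≈ 1# → x * b ≈ 1# → a ≈ b
  inverse-unique {x} {a} {b} xa≈1 xb≈1 = begin
    a            ≈⟨ *-identityʳ a ⟨
    a * 1#       ≈⟨ *-congˡ xb≈1 ⟨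
    a * (x * b)  ≈⟨ *-assoc a x b ⟨
    (a * x) * b  ≈⟨ *-congʳ (trans (*-comm a x) xa≈1) ⟩
    1# * b       ≈⟨ *-identityˡ b ⟩
    b            ∎

  halve-inverse : ∀ x k → x * nat (2 ℕ.* k) ≈ 1# → nat 2 * (x * nat k) ≈ 1#
  halve-inverse x k x[2k]≈1 = begin
    nat 2 * (x * nat k)  ≈⟨ *.x∙yz≈y∙xz (nat 2) x (nat k) ⟩
    x * (nat 2 * nat k)  ≈⟨ *-congˡ (nat-homo-* 2 k) ⟨
    x * nat (2 ℕ.* k)    ≈⟨ x[2k]≈1 ⟩
    1#                   ∎

module WordSign {c ℓ} (R : CommutativeRing c ℓ) (p q : ℕ) where
  open CommutativeRing R renaming (Carrier to K) hiding (zero)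
  open import Algebra.Properties.Ring ring using (-‿distribˡ-*; -‿distribʳ-*; -‿involutive; -0#≈0#)
  open import Algebra.Properties.CommutativeSemigroup (CommutativeMonoid.commutativeSemigroup Bool.∨-commutativeMonoid)
    using (x∙yz≈y∙xz)
  open import Relation.Binary.Reasoning.Setoid setoid
  open KM R

  Letter : Set
  Letter = Fin (p ℕ.* q)

  -- sgnW p q (x ∷ w) unfolds to leadSign x w * sgnW p q w.
  leadSign : Letter → Word p q → K
  leadSign x w = if memB p q x w then 0# else sgn (length (filter (Fin._<? x) w))

  memB-↭ : ∀ x {u v} → u ↭ v → memB p q x u ≡ memB p q x v
  memB-↭ x ↭.refl         = ≡.refl
  memB-↭ x (↭.prep y π)   = ≡.cong (⌊ x Fin.≟ y ⌋ ∨_) (memB-↭ x π)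
  memB-↭ x (↭.swap y z π) = ≡.trans (≡.cong (λ b → ⌊ x Fin.≟ y ⌋ ∨ (⌊ x Fin.≟ z ⌋ ∨ b)) (memB-↭ x π))
                                    (x∙yz≈y∙xz ⌊ x Fin.≟ y ⌋ ⌊ x Fin.≟ z ⌋ _)
  memB-↭ x (↭.trans π π′) = ≡.trans (memB-↭ x π) (memB-↭ x π′)

  leadSign-↭ : ∀ x {u v} → u ↭ v → leadSign x u ≡ leadSign x v
  leadSign-↭ x π = ≡.cong₂ (λ b n → if b then 0# else sgn n) (memB-↭ x π) (↭-length (filter-↭ (Fin._<? x) π))

  support-↭ : ∀ {u v} → u ↭ v → support p q u ≡ support p q v
  support-↭ ↭.refl         = ≡.refl
  support-↭ (↭.prep x π)   = ≡.cong (_[ x ]≔ true) (support-↭ π)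
  support-↭ (↭.swap x y π) with x Fin.≟ y
  ... | yes ≡.refl = ≡.cong (λ S → (S [ x ]≔ true) [ x ]≔ true) (support-↭ π)
  ... | no x≢y     = ≡.trans (≡.cong (λ S → (S [ y ]≔ true) [ x ]≔ true) (support-↭ π)) (Vec.[]≔-commutes _ y x (x≢y ∘ ≡.sym))
  support-↭ (↭.trans π π′) = ≡.trans (support-↭ π) (support-↭ π′)

  leadSign-self : ∀ x w → leadSign x (x ∷ w) ≡ 0#
  leadSign-self x w with x Fin.≟ x
  ... | yes _  = ≡.refl
  ... | no x≢x = ⊥-elim (x≢x ≡.refl)

  leadSign-∷-< : ∀ {x y} w → y < x → leadSign x (y ∷ w) ≈ - leadSign x w
  leadSign-∷-< {x} {y} w y<x with x Fin.≟ y
  ... | yes ≡.refl = ⊥-elim (Fin.<-irrefl ≡.refl y<x)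
  ... | no _ rewrite List.filter-accept (Fin._<? x) {y} {w} y<x with memB p q x w
  ...   | true  = sym -0#≈0#
  ...   | false = refl

  leadSign-∷-> : ∀ {x y} w → x < y → leadSign x (y ∷ w) ≡ leadSign x w
  leadSign-∷-> {x} {y} w x<y with x Fin.≟ y
  ... | yes ≡.refl = ⊥-elim (Fin.<-irrefl ≡.refl x<y)
  ... | no _ rewrite List.filter-reject (Fin._<? x) {y} {w} (Fin.<-asym x<y) = ≡.refl

  leadSign-swap : ∀ x y w → leadSign x (y ∷ w) * leadSign y w ≈ - (leadSign y (x ∷ w) * leadSign x w)
  leadSign-swap x y w with Fin.<-cmp x y
  ... | tri≈ _ ≡.refl _ rewrite leadSign-self x w = trans (zeroˡ _) (sym (trans (-‿cong (zeroˡ _)) -0#≈0#))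
  ... | tri< x<y _ _ = begin
    leadSign x (y ∷ w) * leadSign y w      ≡⟨ ≡.cong (_* _) (leadSign-∷-> w x<y) ⟩
    leadSign x w * leadSign y w            ≈⟨ *-comm _ _ ⟩
    leadSign y w * leadSign x w            ≈⟨ -‿involutive _ ⟨
    - - (leadSign y w * leadSign x w)      ≈⟨ -‿cong (-‿distribˡ-* _ _) ⟩
    - (- leadSign y w * leadSign x w)      ≈⟨ -‿cong (*-congʳ (leadSign-∷-< w x<y)) ⟨
    - (leadSign y (x ∷ w) * leadSign x w)  ∎
  ... | tri> _ _ y<x = begin
    leadSign x (y ∷ w) * leadSign y w      ≈⟨ *-congʳ (leadSign-∷-< w y<x) ⟩
    - leadSign x w * leadSign y w          ≈⟨ -‿distribˡ-* _ _ ⟨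
    - (leadSign x w * leadSign y w)        ≈⟨ -‿cong (*-comm _ _) ⟩
    - (leadSign y w * leadSign x w)        ≡⟨ ≡.cong (λ z → - (z * _)) (leadSign-∷-> w y<x) ⟨
    - (leadSign y (x ∷ w) * leadSign x w)  ∎

  sgnW-swap : ∀ w₀ x y w → sgnW p q (w₀ ++ x ∷ y ∷ w) ≈ - sgnW p q (w₀ ++ y ∷ x ∷ w)
  sgnW-swap [] x y w = begin
    leadSign x (y ∷ w) * (leadSign y w * sgnW p q w)      ≈⟨ *-assoc _ _ _ ⟨
    (leadSign x (y ∷ w) * leadSign y w) * sgnW p q w      ≈⟨ *-congʳ (leadSign-swap x y w) ⟩
    - (leadSign y (x ∷ w) * leadSign x w) * sgnW p q w    ≈⟨ -‿distribˡ-* _ _ ⟨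
    - ((leadSign y (x ∷ w) * leadSign x w) * sgnW p q w)  ≈⟨ -‿cong (*-assoc _ _ _) ⟩
    - (leadSign y (x ∷ w) * (leadSign x w * sgnW p q w))  ∎
  sgnW-swap (a ∷ w₀) x y w = begin
    leadSign a (w₀ ++ x ∷ y ∷ w) * sgnW p q (w₀ ++ x ∷ y ∷ w)
      ≈⟨ *-cong (reflexive (leadSign-↭ a (++⁺ˡ w₀ (↭.swap x y ↭.refl)))) (sgnW-swap w₀ x y w) ⟩
    leadSign a (w₀ ++ y ∷ x ∷ w) * - sgnW p q (w₀ ++ y ∷ x ∷ w)
      ≈⟨ -‿distribʳ-* _ _ ⟨
    - (leadSign a (w₀ ++ y ∷ x ∷ w) * sgnW p q (w₀ ++ y ∷ x ∷ w))  ∎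

  sgnW-moveToFront : ∀ n (g : Fin (suc n) → Letter) k w₀ →
    sgnW p q (w₀ ++ g k ∷ tabulate (g ∘ punchIn k)) ≈ sgn (toℕ k) * sgnW p q (w₀ ++ tabulate g)
  sgnW-moveToFront n       g zero    w₀ = sym (*-identityˡ _)
  sgnW-moveToFront (suc n) g (suc k) w₀ = begin
    sgnW p q (w₀ ++ g (suc k) ∷ g zero ∷ rest)             ≈⟨ sgnW-swap w₀ _ _ _ ⟩
    - sgnW p q (w₀ ++ g zero ∷ g (suc k) ∷ rest)           ≡⟨ ≡.cong (λ w → - sgnW p q w) (List.++-assoc w₀ [ g zero ] _) ⟨
    - sgnW p q ((w₀ ++ [ g zero ]) ++ g (suc k) ∷ rest)    ≈⟨ -‿cong (sgnW-moveToFront n (g ∘ suc) k (w₀ ++ [ g zero ])) ⟩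
    - (sgn (toℕ k) * sgnW p q ((w₀ ++ [ g zero ]) ++ tabulate (g ∘ suc)))
                                                          ≈⟨ -‿distribˡ-* _ _ ⟩
    - sgn (toℕ k) * sgnW p q ((w₀ ++ [ g zero ]) ++ tabulate (g ∘ suc))
                                                          ≡⟨ ≡.cong (λ w → - sgn (toℕ k) * sgnW p q w) (List.++-assoc w₀ [ g zero ] _) ⟩
    - sgn (toℕ k) * sgnW p q (w₀ ++ tabulate g)            ∎
    where rest = tabulate (g ∘ suc ∘ punchIn k)

module Terms {c ℓ} (R : CommutativeRing c ℓ) (p q : ℕ) where
  open CommutativeRing R renaming (Carrier to K) hiding (zero)
  open import Relation.Binary.Reasoning.Setoid setoid
  open KM R
  open Term public
  open Arithmetic R

  _⊞_ : Mono p q → Mono p q → Mono p q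
  _⊞_ = zipWith ℕ._+_

  module ⊞-Solver = Algebra.Solver.CommutativeMonoid (monomialMonoid (p ℕ.+ q))

  _⊗_ : Term p q → Term p q → Term p q
  s ⊗ t = tm (coef s * coef t) (mono s ⊞ mono t) (word s ++ word t)

  scaleₜ : K → Term p q → Term p q
  scaleₜ r t = tm (r * coef t) (mono t) (word t)

  prodₜ : List (Term p q) → Term p q
  prodₜ = foldr _⊗_ (tm 1# (zeroMono p q) [])

  prodL-map-[] : ∀ {a} {A : Set a} (F : A → Term p q) xs → prodL p q (map (λ x → [ F x ]) xs) ≡ [ prodₜ (map F xs) ]
  prodL-map-[] F []       = ≡.refl
  prodL-map-[] F (x ∷ xs) rewrite prodL-map-[] F xs = ≡.refl

  xMono : Fin p → Mono p q
  xMono α = zeroMono p q [ α ↑ˡ q ]≔ 1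

  yMono : Fin q → Mono p q
  yMono μ = zeroMono p q [ p ↑ʳ μ ]≔ 1

  zαₜ : Fin p → Term p q
  zαₜ α = tm 1# (xMono α) []

  zμₜ : Fin q → Term p q
  zμₜ μ = tm 1# (yMono μ) []

  ωₜ : Fin p → Fin q → Term p q
  ωₜ α μ = tm 1# (zeroMono p q) [ combine α μ ]

  zProdₜ : ∀ {n} → Vec (Fin p) n → Term p q
  zProdₜ {n} b = prodₜ (map (λ j → zαₜ (lookup b j)) (allFin n))

  zProdMono : ∀ {n} → Vec (Fin p) n → Mono p q
  zProdMono []      = zeroMono p q
  zProdMono (x ∷ b) = xMono x ⊞ zProdMono b

  zProdₜ-∷ : ∀ {n} x (b : Vec (Fin p) n) → zProdₜ (x ∷ b) ≡ zαₜ x ⊗ zProdₜ b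
  zProdₜ-∷ x b = ≡.cong prodₜ (map-allFin-suc (λ j → zαₜ (lookup (x ∷ b) j)))

  zProdₜ-word : ∀ {n} (b : Vec (Fin p) n) → word (zProdₜ b) ≡ []
  zProdₜ-word []      = ≡.refl
  zProdₜ-word (x ∷ b) = ≡.trans (≡.cong word (zProdₜ-∷ x b)) (zProdₜ-word b)

  zProdₜ-mono : ∀ {n} (b : Vec (Fin p) n) → mono (zProdₜ b) ≡ zProdMono b
  zProdₜ-mono []      = ≡.refl
  zProdₜ-mono (x ∷ b) = ≡.trans (≡.cong mono (zProdₜ-∷ x b)) (≡.cong (xMono x ⊞_) (zProdₜ-mono b))

  zProdₜ-coef : ∀ {n} (b : Vec (Fin p) n) → coef (zProdₜ b) ≈ 1#
  zProdₜ-coef []      = refl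
  zProdₜ-coef (x ∷ b) = trans (reflexive (≡.cong coef (zProdₜ-∷ x b))) (trans (*-identityˡ _) (zProdₜ-coef b))

  private
    module ⊞ = Algebra.Properties.CommutativeSemigroup (CommutativeMonoid.commutativeSemigroup (monomialMonoid (p ℕ.+ q)))

  zProdMono-insertAt : ∀ {n} (b : Vec (Fin p) n) k x → zProdMono (insertAt b k x) ≡ xMono x ⊞ zProdMono b
  zProdMono-insertAt b       zero    x = ≡.refl
  zProdMono-insertAt (y ∷ b) (suc k) x =
    ≡.trans (≡.cong (xMono y ⊞_) (zProdMono-insertAt b k x)) (⊞.x∙yz≈y∙xz (xMono y) (xMono x) (zProdMono b))

  ∑-lookup-xMono : ∀ y → ∑[ x ← allFin p ] nat (lookup (xMono y) (x ↑ˡ q)) ≈ 1#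
  ∑-lookup-xMono y = begin
    ∑[ x ← allFin p ] nat (lookup (xMono y) (x ↑ˡ q))  ≈⟨ ∑-allFin-single p y _ off-y ⟩
    nat (lookup (xMono y) (y ↑ˡ q))                    ≡⟨ ≡.cong nat (Vec.lookup∘update (y ↑ˡ q) (zeroMono p q) 1) ⟩
    1# + 0#                                            ≈⟨ +-identityʳ 1# ⟩
    1#                                                 ∎
    where
    off-y : ∀ x → x ≢ y → nat (lookup (xMono y) (x ↑ˡ q)) ≈ 0#
    off-y x x≢y = reflexive (≡.cong nat (≡.trans (Vec.lookup∘update′ (x≢y ∘ Fin.↑ˡ-injective q x y) (zeroMono p q) 1)
                                                 (Vec.lookup-replicate (x ↑ˡ q) 0)))

  zProdMono-degree : ∀ {n} (b : Vec (Fin p) n) → ∑[ x ← allFin p ] nat (lookup (zProdMono b) (x ↑ˡ q)) ≈ nat n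
  zProdMono-degree []      = ∑-zero (allFin p) (λ x → reflexive (≡.cong nat (Vec.lookup-replicate (x ↑ˡ q) 0)))
  zProdMono-degree {suc n} (y ∷ b) = begin
    ∑[ x ← allFin p ] nat (lookup (xMono y ⊞ zProdMono b) (x ↑ˡ q))
      ≈⟨ ∑-cong (allFin p) (λ x → trans (reflexive (≡.cong nat (Vec.lookup-zipWith ℕ._+_ (x ↑ˡ q) (xMono y) (zProdMono b))))
                                        (nat-homo-+ (lookup (xMono y) (x ↑ˡ q)) _)) ⟩
    ∑[ x ← allFin p ] (nat (lookup (xMono y) (x ↑ˡ q)) + nat (lookup (zProdMono b) (x ↑ˡ q)))
      ≈⟨ ∑-distrib-+ (allFin p) _ _ ⟩
    ∑[ x ← allFin p ] nat (lookup (xMono y) (x ↑ˡ q)) + ∑[ x ← allFin p ] nat (lookup (zProdMono b) (x ↑ˡ q))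
      ≈⟨ +-cong (∑-lookup-xMono y) (zProdMono-degree b) ⟩
    nat (suc n)
      ∎

  ∑-suc-lookup-zProdMono : ∀ {n} (b : Vec (Fin p) n) → ∑[ x ← allFin p ] nat (suc (lookup (zProdMono b) (x ↑ˡ q))) ≈ nat (p ℕ.+ n)
  ∑-suc-lookup-zProdMono {n} b = begin
    ∑[ x ← allFin p ] (1# + nat (lookup (zProdMono b) (x ↑ˡ q)))  ≈⟨ ∑-distrib-+ (allFin p) _ _ ⟩
    ∑[ _ ← allFin p ] 1# + ∑[ x ← allFin p ] nat (lookup (zProdMono b) (x ↑ˡ q))
                                                                  ≈⟨ +-cong (trans (∑-allFin-const p 1#) (*-identityʳ _)) (zProdMono-degree b) ⟩
    nat p + nat n                                                 ≈⟨ nat-homo-+ p n ⟨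
    nat (p ℕ.+ n)                                                 ∎

  ∂ₜ : Fin (p ℕ.+ q) → Term p q → Term p q
  ∂ₜ i t = tm (coef t * nat (lookup (mono t) i)) (mono t [ i ]≔ (lookup (mono t) i ℕ.∸ 1)) (word t)

  ∂ₜ-xMono : ∀ x c m w → ∂ₜ (x ↑ˡ q) (tm c (xMono x ⊞ m) w) ≡ tm (c * nat (suc (lookup m (x ↑ˡ q)))) m w
  ∂ₜ-xMono x c m w = ≡.trans (≡.cong (λ v → ∂ₜ i (tm c v w)) (zipWith-+-unit i m))
    (≡.trans (≡.cong (λ e → tm (c * nat e) ((m [ i ]≔ s) [ i ]≔ (e ℕ.∸ 1)) w) (Vec.lookup∘update i m s))
             (≡.cong (λ v → tm (c * nat s) v w) (≡.trans (Vec.[]≔-idempotent m i) (Vec.[]≔-lookup m i))))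
    where
    i = x ↑ˡ q
    s = suc (lookup m i)

  ωProdₜ : ∀ {n} → Vec (Fin p) n → (Fin n → Fin q) → Term p q
  ωProdₜ b col = tm 1# (zeroMono p q) (tabulate (λ i → combine (lookup b i) (col i)))

  module _ {a} {A : Set a} (f : A → Fin p) (g : A → Fin q) where

    ωProdMap : List A → Term p q
    ωProdMap xs = prodₜ (map (λ j → ωₜ (f j) (g j)) xs)

    ωProdMap-word : ∀ xs → word (ωProdMap xs) ≡ map (λ j → combine (f j) (g j)) xs
    ωProdMap-word []       = ≡.refl
    ωProdMap-word (x ∷ xs) = ≡.cong (combine (f x) (g x) ∷_) (ωProdMap-word xs)

    ωProdMap-mono : ∀ xs → mono (ωProdMap xs) ≡ zeroMono p q
    ωProdMap-mono []       = ≡.refl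
    ωProdMap-mono (x ∷ xs) = ≡.trans (≡.cong (zeroMono p q ⊞_) (ωProdMap-mono xs)) (Vec.zipWith-identityˡ ℕ.+-identityˡ _)

    ωProdMap-coef : ∀ xs → coef (ωProdMap xs) ≈ 1#
    ωProdMap-coef []       = refl
    ωProdMap-coef (x ∷ xs) = trans (*-identityˡ _) (ωProdMap-coef xs)

  diag : Vec (Fin p) q → Fin q → Fin (p ℕ.* q)
  diag a j = combine (lookup a j) j

  φₜ : K → Vec (Fin p) q → Term p q
  φₜ r a = scaleₜ r (zProdₜ a ⊗ ωProdMap (lookup a) (λ j → j) (allFin q))

  φₜ-word : ∀ r a → word (φₜ r a) ≡ tabulate (diag a)
  φₜ-word r a = ≡.trans (≡.cong (_++ word (ωProdMap (lookup a) (λ j → j) (allFin q))) (zProdₜ-word a))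
    (≡.trans (ωProdMap-word (lookup a) (λ j → j) (allFin q)) (List.map-tabulate (λ j → j) (diag a)))

  φₜ-mono : ∀ r a → mono (φₜ r a) ≡ zProdMono a
  φₜ-mono r a = ≡.trans (≡.cong₂ _⊞_ (zProdₜ-mono a) (ωProdMap-mono (lookup a) (λ j → j) (allFin q)))
                        (Vec.zipWith-identityʳ ℕ.+-identityʳ (zProdMono a))

  φₜ-coef : ∀ r a → coef (φₜ r a) ≈ r
  φₜ-coef r a = trans (*-congˡ (*-cong (zProdₜ-coef a) (ωProdMap-coef (lookup a) (λ j → j) (allFin q))))
                      (trans (*-congˡ (*-identityˡ 1#)) (*-identityʳ r))

module Expansions {c ℓ} (R : CommutativeRing c ℓ) (p q : ℕ) where
  open CommutativeRing R renaming (Carrier to K) hiding (zero)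
  open import Relation.Binary.Reasoning.Setoid setoid
  open KM R
  open Arithmetic R
  open Terms R p q

  detω : ∀ n → Vec (Fin p) n → (Fin n → Fin q) → Elem p q
  detω n b col = det p q n (λ r c′ → ω p q (lookup b r) (col c′))

  ∑-tuples-suc : ∀ n (F : Vec (Fin p) (suc n) → K) →
    ∑ (tuples p q (suc n)) F ≈ ∑[ x ← allFin p ] ∑[ b ← tuples p q n ] F (x ∷ b)
  ∑-tuples-suc n F = trans (∑-concatMap (λ x → map (x ∷_) (tuples p q n)) (allFin p) F)
                           (∑-cong (allFin p) (λ x → reflexive (∑-map (x ∷_) (tuples p q n) F)))

  ∑-tuples-insertAt : ∀ n k (F : Vec (Fin p) (suc n) → K) →
    ∑[ x ← allFin p ] ∑[ b ← tuples p q n ] F (insertAt b k x) ≈ ∑ (tuples p q (suc n)) F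
  ∑-tuples-insertAt n       zero    F = sym (∑-tuples-suc n F)
  ∑-tuples-insertAt (suc n) (suc k) F = begin
    ∑[ x ← allFin p ] ∑[ b ← tuples p q (suc n) ] F (insertAt b (suc k) x)
      ≈⟨ ∑-cong (allFin p) (λ x → ∑-tuples-suc n (λ b → F (insertAt b (suc k) x))) ⟩
    ∑[ x ← allFin p ] ∑[ y ← allFin p ] ∑[ b ← tuples p q n ] F (y ∷ insertAt b k x)
      ≈⟨ ∑-comm (allFin p) (allFin p) _ ⟩
    ∑[ y ← allFin p ] ∑[ x ← allFin p ] ∑[ b ← tuples p q n ] F (y ∷ insertAt b k x)
      ≈⟨ ∑-cong (allFin p) (λ y → ∑-tuples-insertAt n k (λ b → F (y ∷ b))) ⟩
    ∑[ y ← allFin p ] ∑[ b ← tuples p q (suc n) ] F (y ∷ b)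
      ≈⟨ ∑-tuples-suc (suc n) F ⟨
    ∑ (tuples p q (suc (suc n))) F
      ∎

  ∑-ιw-tabulate : ∀ n (g : Fin (suc n) → Fin (p ℕ.* q)) l (F : K × Word p q → K) →
    ∑ (ιw p q l (tabulate g)) F
      ≈ ∑[ j ← allFin (suc n) ] (if ⌊ g j Fin.≟ l ⌋ then F (sgn (toℕ j) , tabulate (g ∘ punchIn j)) else 0#)
  ∑-ιw-tabulate zero    g l F = trans (∑-++ (if ⌊ g zero Fin.≟ l ⌋ then [ 1# , [] ] else []) [] F) (+-congʳ (∑-if _ _ F))
  ∑-ιw-tabulate (suc n) g l F = begin
    ∑ (ιw p q l (tabulate g)) F
      ≈⟨ ∑-++ (if ⌊ g zero Fin.≟ l ⌋ then [ 1# , tabulate (g ∘ suc) ] else []) _ F ⟩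
    ∑ (if ⌊ g zero Fin.≟ l ⌋ then [ 1# , tabulate (g ∘ suc) ] else []) F + ∑ (map _ (ιw p q l (tabulate (g ∘ suc)))) F
      ≈⟨ +-cong (∑-if _ _ F) (reflexive (∑-map _ (ιw p q l (tabulate (g ∘ suc))) F)) ⟩
    _ + ∑ (ιw p q l (tabulate (g ∘ suc))) _
      ≈⟨ +-congˡ (∑-ιw-tabulate n (g ∘ suc) l _) ⟩
    _ + ∑[ j ← allFin (suc n) ] (if ⌊ g (suc j) Fin.≟ l ⌋ then F (- sgn (toℕ j) , g zero ∷ tabulate (g ∘ suc ∘ punchIn j)) else 0#)
      ≡⟨ ∑-allFin-suc (suc n) _ ⟨
    ∑[ j ← allFin (suc (suc n)) ] (if ⌊ g j Fin.≟ l ⌋ then F (sgn (toℕ j) , tabulate (g ∘ punchIn j)) else 0#)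
      ∎

  ∑-·-[] : ∀ s g (F : Term p q → K) → ∑ (_·_ p q [ s ] g) F ≈ ∑ g (F ∘ (s ⊗_))
  ∑-·-[] s g F = trans (∑-++ (map (s ⊗_) g) [] F) (trans (+-identityʳ _) (reflexive (∑-map (s ⊗_) g F)))

  ∑-det-suc : ∀ n (N : Fin (suc n) → Fin (suc n) → Elem p q) (F : Term p q → K) →
    ∑ (det p q (suc n) N) F
      ≈ ∑[ k ← allFin (suc n) ] ∑ (_·_ p q (N zero k) (det p q n (λ r c′ → N (suc r) (punchIn k c′)))) (F ∘ scaleₜ (sgn (toℕ k)))
  ∑-det-suc n N F = trans (∑-concat (map expand (allFin (suc n))) F) (trans (reflexive (∑-map expand (allFin (suc n)) (λ xs → ∑ xs F)))
    (∑-cong (allFin (suc n)) (λ k → reflexive (∑-map (scaleₜ (sgn (toℕ k))) (_·_ p q (N zero k) (det p q n (minor k))) F))))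
    where
    minor : Fin (suc n) → Fin n → Fin n → Elem p q
    minor k r c′ = N (suc r) (punchIn k c′)
    expand : Fin (suc n) → Elem p q
    expand k = scale p q (sgn (toℕ k)) (_·_ p q (N zero k) (det p q n (minor k)))

  ∑-h : ∀ f (F : Term p q → K) →
    ∑ (h p q f) F ≈ ∑[ α ← allFin p ] ∑[ μ ← allFin q ] ∑ (A* p q α μ f) (F ∘ (zμₜ μ ⊗_) ∘ ∂ₜ (α ↑ˡ q))
  ∑-h f F = begin
    ∑ (concat (concatMap (λ α → map (summand α) (allFin q)) (allFin p))) F
      ≈⟨ ∑-concat (concatMap (λ α → map (summand α) (allFin q)) (allFin p)) F ⟩
    ∑ (concatMap (λ α → map (summand α) (allFin q)) (allFin p)) (λ g → ∑ g F)
      ≈⟨ ∑-concatMap (λ α → map (summand α) (allFin q)) (allFin p) _ ⟩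
    ∑[ α ← allFin p ] ∑ (map (summand α) (allFin q)) (λ g → ∑ g F)
      ≈⟨ ∑-cong (allFin p) (λ α → reflexive (∑-map (summand α) (allFin q) _)) ⟩
    ∑[ α ← allFin p ] ∑[ μ ← allFin q ] ∑ (summand α μ) F
      ≈⟨ ∑-cong (allFin p) (λ α → ∑-cong (allFin q) (λ μ →
           trans (∑-·-[] (zμₜ μ) (∂ p q (α ↑ˡ q) (A* p q α μ f)) F) (reflexive (∑-map (∂ₜ (α ↑ˡ q)) (A* p q α μ f) _)))) ⟩
    ∑[ α ← allFin p ] ∑[ μ ← allFin q ] ∑ (A* p q α μ f) (F ∘ (zμₜ μ ⊗_) ∘ ∂ₜ (α ↑ˡ q))
      ∎
    where
    summand : Fin p → Fin q → Elem p q
    summand α μ = _·_ p q (zμ p q μ) (∂ p q (α ↑ˡ q) (A* p q α μ f))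

  ∑-A* : ∀ α μ f (F : Term p q → K) →
    ∑ (A* p q α μ f) F ≈ ∑[ t ← f ] ∑[ rw ← ιw p q (combine α μ) (word t) ] F (tm (coef t * proj₁ rw) (mono t) (proj₂ rw))
  ∑-A* α μ f F = trans (∑-concatMap _ f F) (∑-cong f (λ t → reflexive (∑-map _ (ιw p q (combine α μ) (word t)) F)))

  ∑-φKM : ∀ κ (F : Term p q → K) → ∑ (φKM p q κ) F ≈ ∑[ a ← tuples p q q ] F (φₜ (pow κ q) a)
  ∑-φKM κ F = begin
    ∑ (φKM p q κ) F                                               ≡⟨ ∑-map (scaleₜ (pow κ q)) (concat (map summand (tuples p q q))) F ⟩
    ∑ (concat (map summand (tuples p q q))) (F ∘ scaleₜ (pow κ q)) ≈⟨ ∑-concat (map summand (tuples p q q)) _ ⟩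
    ∑ (map summand (tuples p q q)) (λ g → ∑ g (F ∘ scaleₜ (pow κ q))) ≡⟨ ∑-map summand (tuples p q q) _ ⟩
    ∑[ a ← tuples p q q ] ∑ (summand a) (F ∘ scaleₜ (pow κ q))
      ≈⟨ ∑-cong (tuples p q q) (λ a → trans (reflexive (≡.cong (λ g → ∑ g (F ∘ scaleₜ (pow κ q)))
                                                              (≡.cong₂ (_·_ p q) (prodL-map-[] (λ j → zαₜ (lookup a j)) (allFin q))
                                                                                 (prodL-map-[] (λ j → ωₜ (lookup a j) j) (allFin q)))))
                                           (+-identityʳ _)) ⟩
    ∑[ a ← tuples p q q ] F (φₜ (pow κ q) a)                       ∎
    where
    summand : Vec (Fin p) q → Elem p q
    summand a = _·_ p q (prodL p q (map (λ j → zα p q (lookup a j)) (allFin q))) (prodL p q (map (λ j → ω p q (lookup a j) j) (allFin q)))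

module Coefficients {c ℓ} (R : CommutativeRing c ℓ) (p q : ℕ) (m : KM.Mono R p q) (S : Vec Bool (p ℕ.* q)) where
  open CommutativeRing R renaming (Carrier to K) hiding (zero)
  open import Relation.Binary.Reasoning.Setoid setoid
  open KM R
  open Arithmetic R
  open WordSign R p q
  open Terms R p q
  open Expansions R p q
  module *-Solver = Algebra.Solver.CommutativeMonoid *-commutativeMonoid

  matches : Term p q → Bool
  matches t = ⌊ Vec.≡-dec ℕ._≟_ (mono t) m ⌋ ∧ ⌊ Vec.≡-dec Bool._≟_ (support p q (word t)) S ⌋

  -- coeff p q f m S unfolds to ∑ f coeffₜ.
  coeffₜ : Term p q → K
  coeffₜ t = if matches t then coef t * sgnW p q (word t) else 0#

  coeffₜ-∝ : ∀ {s t} k → mono s ≡ mono t → support p q (word s) ≡ support p q (word t) →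
    coef s * sgnW p q (word s) ≈ k * (coef t * sgnW p q (word t)) → coeffₜ s ≈ k * coeffₜ t
  coeffₜ-∝ {s} {t} k ms≡mt Ss≡St cs≈kct
    with matches s | matches t | ≡.cong₂ (λ v V → ⌊ Vec.≡-dec ℕ._≟_ v m ⌋ ∧ ⌊ Vec.≡-dec Bool._≟_ V S ⌋) ms≡mt Ss≡St
  ... | true  | true  | _ = cs≈kct
  ... | false | false | _ = sym (zeroʳ k)

  coeffₜ-cong : ∀ {s t} → mono s ≡ mono t → support p q (word s) ≡ support p q (word t) →
    coef s * sgnW p q (word s) ≈ coef t * sgnW p q (word t) → coeffₜ s ≈ coeffₜ t
  coeffₜ-cong {s} {t} ms≡mt Ss≡St e = trans (coeffₜ-∝ {s} {t} 1# ms≡mt Ss≡St (trans e (sym (*-identityˡ _)))) (*-identityˡ _)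

  coeffₜ-≗ : ∀ {s t} → coef s ≈ coef t → mono s ≡ mono t → word s ≡ word t → coeffₜ s ≈ coeffₜ t
  coeffₜ-≗ {s} {t} cs≈ct ms≡mt ws≡wt =
    coeffₜ-cong {s} {t} ms≡mt (≡.cong (support p q) ws≡wt) (*-cong cs≈ct (reflexive (≡.cong (sgnW p q) ws≡wt)))

  coeff-scale : ∀ r f → ∑ (scale p q r f) coeffₜ ≈ r * ∑ f coeffₜ
  coeff-scale r f = trans (reflexive (∑-map (scaleₜ r) f coeffₜ))
    (trans (∑-cong f (λ t → coeffₜ-∝ {scaleₜ r t} {t} r ≡.refl ≡.refl (*-assoc _ _ _))) (sym (*-distribˡ-∑ r f coeffₜ)))

  rowPrefixₜ : ∀ {n} → Term p q → Fin p → Fin (suc n) → (Fin (suc n) → Fin q) → Term p q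
  rowPrefixₜ t x k col = scaleₜ (sgn (toℕ k)) ((t ⊗ zαₜ x) ⊗ ωₜ x (col k))

  coeffₜ-regroup-row : ∀ {n} t x (b : Vec (Fin p) n) k (col : Fin (suc n) → Fin q) d →
    coeffₜ ((t ⊗ zProdₜ (x ∷ b)) ⊗ scaleₜ (sgn (toℕ k)) (ωₜ x (col k) ⊗ d))
      ≈ coeffₜ ((rowPrefixₜ t x k col ⊗ zProdₜ b) ⊗ d)
  coeffₜ-regroup-row t x b k col d = coeffₜ-≗ {lhs} {rhs} coef≈ mono≡ word≡
    where
    s = sgn (toℕ k)
    lhs = (t ⊗ zProdₜ (x ∷ b)) ⊗ scaleₜ s (ωₜ x (col k) ⊗ d)
    rhs = (rowPrefixₜ t x k col ⊗ zProdₜ b) ⊗ d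

    coef≈ : coef lhs ≈ coef rhs
    coef≈ = begin
      (coef t * coef (zProdₜ (x ∷ b))) * (s * (1# * coef d))
        ≈⟨ *-congʳ (*-congˡ (zProdₜ-coef (x ∷ b))) ⟩
      (coef t * 1#) * (s * (1# * coef d))
        ≈⟨ solve 3 (λ a z e → (a ⊕ id) ⊕ (z ⊕ (id ⊕ e)) ⊜ ((z ⊕ ((a ⊕ id) ⊕ id)) ⊕ id) ⊕ e) refl (coef t) s (coef d) ⟩
      ((s * ((coef t * 1#) * 1#)) * 1#) * coef d
        ≈⟨ *-congʳ (*-congˡ (zProdₜ-coef b)) ⟨
      ((s * ((coef t * 1#) * 1#)) * coef (zProdₜ b)) * coef d
        ∎
      where open *-Solver

    mono≡ : mono lhs ≡ mono rhs
    mono≡ = ≡.trans (≡.cong (λ v → (mono t ⊞ v) ⊞ (zeroMono p q ⊞ mono d)) (zProdₜ-mono (x ∷ b)))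
      (≡.trans (solve 4 (λ a e z w → (a ⊕ (e ⊕ z)) ⊕ (id ⊕ w) ⊜ (((a ⊕ e) ⊕ id) ⊕ z) ⊕ w)
                        ≡.refl (mono t) (xMono x) (zProdMono b) (mono d))
               (≡.cong (λ v → (((mono t ⊞ xMono x) ⊞ zeroMono p q) ⊞ v) ⊞ mono d) (≡.sym (zProdₜ-mono b))))
      where open ⊞-Solver

    word≡ : word lhs ≡ word rhs
    word≡ = ≡.trans (≡.cong (λ v → (word t ++ v) ++ (ωxk ∷ word d)) (zProdₜ-word (x ∷ b)))
      (≡.trans (≡.sym (List.++-assoc (word t ++ []) [ ωxk ] (word d)))
               (≡.cong (_++ word d) (≡.trans (≡.sym (List.++-identityʳ _))
                                             (≡.cong (((word t ++ []) ++ [ ωxk ]) ++_) (≡.sym (zProdₜ-word b))))))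
      where ωxk = combine x (col k)

  -- Moving ω_{x,col k} back to position k of the word costs (-1)^k, cancelling the cofactor sign.
  coeffₜ-insert-row : ∀ {n} t x (b : Vec (Fin p) n) (k : Fin (suc n)) (col : Fin (suc n) → Fin q) →
    coeffₜ ((rowPrefixₜ t x k col ⊗ zProdₜ b) ⊗ ωProdₜ b (col ∘ punchIn k))
      ≈ coeffₜ ((t ⊗ zProdₜ (insertAt b k x)) ⊗ ωProdₜ (insertAt b k x) col)
  coeffₜ-insert-row {n} t x b k col = coeffₜ-cong {lhs} {rhs} mono≡ support≡ signed≈
    where
    a = insertAt b k x
    s = sgn (toℕ k)
    lhs = (rowPrefixₜ t x k col ⊗ zProdₜ b) ⊗ ωProdₜ b (col ∘ punchIn k)
    rhs = (t ⊗ zProdₜ a) ⊗ ωProdₜ a col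

    g : Fin (suc n) → Fin (p ℕ.* q)
    g i = combine (lookup a i) (col i)

    word-lhs : word lhs ≡ word t ++ g k ∷ tabulate (g ∘ punchIn k)
    word-lhs = ≡.trans
      (≡.cong₂ (λ u v → (((word t ++ []) ++ [ u ]) ++ word (zProdₜ b)) ++ v)
               (≡.cong (λ y → combine y (col k)) (≡.sym (Vec.insertAt-lookup b k x)))
               (List.tabulate-cong (λ i → ≡.cong (λ y → combine y (col (punchIn k i))) (≡.sym (Vec.insertAt-punchIn b k x i)))))
      (≡.trans (≡.cong (λ u → (((word t ++ []) ++ [ g k ]) ++ u) ++ tabulate (g ∘ punchIn k)) (zProdₜ-word b))
               (≡.trans (≡.cong (_++ tabulate (g ∘ punchIn k)) (List.++-identityʳ _))
                        (≡.trans (≡.cong (λ u → (u ++ [ g k ]) ++ tabulate (g ∘ punchIn k)) (List.++-identityʳ (word t)))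
                                 (List.++-assoc (word t) [ g k ] _))))

    word-rhs : word rhs ≡ word t ++ tabulate g
    word-rhs = ≡.cong (_++ tabulate g) (≡.trans (≡.cong (word t ++_) (zProdₜ-word a)) (List.++-identityʳ (word t)))

    mono≡ : mono lhs ≡ mono rhs
    mono≡ = ≡.trans (≡.cong (λ v → (((mono t ⊞ xMono x) ⊞ zeroMono p q) ⊞ v) ⊞ zeroMono p q) (zProdₜ-mono b))
      (≡.trans (solve 3 (λ u e z → (((u ⊕ e) ⊕ id) ⊕ z) ⊕ id ⊜ (u ⊕ (e ⊕ z)) ⊕ id) ≡.refl (mono t) (xMono x) (zProdMono b))
               (≡.cong (λ v → (mono t ⊞ v) ⊞ zeroMono p q) (≡.sym (≡.trans (zProdₜ-mono a) (zProdMono-insertAt b k x)))))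
      where open ⊞-Solver

    support≡ : support p q (word lhs) ≡ support p q (word rhs)
    support≡ = ≡.trans (≡.cong (support p q) word-lhs)
      (≡.trans (support-↭ (++⁺ˡ (word t) (moveToFront-↭ n g k))) (≡.cong (support p q) (≡.sym word-rhs)))

    X = sgnW p q (word t ++ tabulate g)

    signed≈ : coef lhs * sgnW p q (word lhs) ≈ coef rhs * sgnW p q (word rhs)
    signed≈ = begin
      coef lhs * sgnW p q (word lhs)
        ≡⟨ ≡.cong (λ w → coef lhs * sgnW p q w) word-lhs ⟩
      coef lhs * sgnW p q (word t ++ g k ∷ tabulate (g ∘ punchIn k))
        ≈⟨ *-congˡ (sgnW-moveToFront n g k (word t)) ⟩
      (((s * ((coef t * 1#) * 1#)) * coef (zProdₜ b)) * 1#) * (s * X)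
        ≈⟨ *-congʳ (*-congʳ (*-congˡ (zProdₜ-coef b))) ⟩
      (((s * ((coef t * 1#) * 1#)) * 1#) * 1#) * (s * X)
        ≈⟨ solve 3 (λ σ u z → (((σ ⊕ ((u ⊕ id) ⊕ id)) ⊕ id) ⊕ id) ⊕ (σ ⊕ z) ⊜ (σ ⊕ σ) ⊕ (u ⊕ z)) refl s (coef t) X ⟩
      (s * s) * (coef t * X)
        ≈⟨ *-congʳ (sgn*sgn≈1 (toℕ k)) ⟩
      1# * (coef t * X)
        ≈⟨ solve 2 (λ u z → id ⊕ (u ⊕ z) ⊜ ((u ⊕ id) ⊕ id) ⊕ z) refl (coef t) X ⟩
      ((coef t * 1#) * 1#) * X
        ≈⟨ *-congʳ (*-congʳ (*-congˡ (zProdₜ-coef a))) ⟨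
      ((coef t * coef (zProdₜ a)) * 1#) * X
        ≡⟨ ≡.cong (λ w → coef rhs * sgnW p q w) word-rhs ⟨
      coef rhs * sgnW p q (word rhs)
        ∎
      where open *-Solver using (solve; _⊕_; _⊜_; id)

  ∑-detω-expand : ∀ {n} t x (b : Vec (Fin p) n) (col : Fin (suc n) → Fin q) →
    ∑ (detω (suc n) (x ∷ b) col) (λ d → coeffₜ ((t ⊗ zProdₜ (x ∷ b)) ⊗ d))
      ≈ ∑[ k ← allFin (suc n) ] ∑ (detω n b (col ∘ punchIn k)) (λ d → coeffₜ ((rowPrefixₜ t x k col ⊗ zProdₜ b) ⊗ d))
  ∑-detω-expand {n} t x b col = trans (∑-det-suc n (λ r c′ → ω p q (lookup (x ∷ b) r) (col c′)) _)
    (∑-cong (allFin (suc n)) (λ k →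
      trans (∑-·-[] (ωₜ x (col k)) (detω n b (col ∘ punchIn k)) _)
            (∑-cong (detω n b (col ∘ punchIn k)) (coeffₜ-regroup-row t x b k col))))

  ∑-tuples-detω : ∀ n t (col : Fin n → Fin q) →
    ∑[ b ← tuples p q n ] ∑ (detω n b col) (λ d → coeffₜ ((t ⊗ zProdₜ b) ⊗ d))
      ≈ nat (n !) * ∑[ b ← tuples p q n ] coeffₜ ((t ⊗ zProdₜ b) ⊗ ωProdₜ b col)
  ∑-tuples-detω zero t col = begin
    (coeffₜ ((t ⊗ zProdₜ []) ⊗ ωProdₜ [] col) + 0#) + 0#  ≈⟨ +-identityʳ _ ⟩
    coeffₜ ((t ⊗ zProdₜ []) ⊗ ωProdₜ [] col) + 0#         ≈⟨ *-identityˡ _ ⟨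
    1# * (coeffₜ ((t ⊗ zProdₜ []) ⊗ ωProdₜ [] col) + 0#)  ≈⟨ *-congʳ (+-identityʳ 1#) ⟨
    (1# + 0#) * (coeffₜ ((t ⊗ zProdₜ []) ⊗ ωProdₜ [] col) + 0#) ∎
  ∑-tuples-detω (suc n) t col = begin
    ∑[ b ← tuples p q (suc n) ] G b
      ≈⟨ ∑-tuples-suc n G ⟩
    ∑[ x ← allFin p ] ∑[ b ← tuples p q n ] G (x ∷ b)
      ≈⟨ ∑-cong (allFin p) (λ x → ∑-cong (tuples p q n) (λ b → ∑-detω-expand t x b col)) ⟩
    ∑[ x ← allFin p ] ∑[ b ← tuples p q n ] ∑[ k ← allFin (suc n) ] J x k b
      ≈⟨ ∑-cong (allFin p) (λ x → ∑-comm (tuples p q n) (allFin (suc n)) (λ b k → J x k b)) ⟩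
    ∑[ x ← allFin p ] ∑[ k ← allFin (suc n) ] ∑[ b ← tuples p q n ] J x k b
      ≈⟨ ∑-comm (allFin p) (allFin (suc n)) _ ⟩
    ∑[ k ← allFin (suc n) ] ∑[ x ← allFin p ] ∑[ b ← tuples p q n ] J x k b
      ≈⟨ ∑-cong (allFin (suc n)) column ⟩
    ∑[ k ← allFin (suc n) ] (nat (n !) * ∑ (tuples p q (suc n)) H)
      ≈⟨ ∑-allFin-const (suc n) _ ⟩
    nat (suc n) * (nat (n !) * ∑ (tuples p q (suc n)) H)
      ≈⟨ *-assoc _ _ _ ⟨
    (nat (suc n) * nat (n !)) * ∑ (tuples p q (suc n)) H
      ≈⟨ *-congʳ (nat-homo-* (suc n) (n !)) ⟨
    nat (suc n !) * ∑ (tuples p q (suc n)) H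
      ∎
    where
    G : Vec (Fin p) (suc n) → K
    G b = ∑ (detω (suc n) b col) (λ d → coeffₜ ((t ⊗ zProdₜ b) ⊗ d))
    H : Vec (Fin p) (suc n) → K
    H a = coeffₜ ((t ⊗ zProdₜ a) ⊗ ωProdₜ a col)
    J : Fin p → Fin (suc n) → Vec (Fin p) n → K
    J x k b = ∑ (detω n b (col ∘ punchIn k)) (λ d → coeffₜ ((rowPrefixₜ t x k col ⊗ zProdₜ b) ⊗ d))

    column : ∀ k → ∑[ x ← allFin p ] ∑[ b ← tuples p q n ] J x k b ≈ nat (n !) * ∑ (tuples p q (suc n)) H
    column k = begin
      ∑[ x ← allFin p ] ∑[ b ← tuples p q n ] J x k b
        ≈⟨ ∑-cong (allFin p) (λ x → ∑-tuples-detω n (rowPrefixₜ t x k col) (col ∘ punchIn k)) ⟩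
      ∑[ x ← allFin p ] (nat (n !) * ∑[ b ← tuples p q n ] coeffₜ ((rowPrefixₜ t x k col ⊗ zProdₜ b) ⊗ ωProdₜ b (col ∘ punchIn k)))
        ≈⟨ ∑-cong (allFin p) (λ x → *-congˡ (∑-cong (tuples p q n) (λ b → coeffₜ-insert-row t x b k col))) ⟩
      ∑[ x ← allFin p ] (nat (n !) * ∑[ b ← tuples p q n ] H (insertAt b k x))
        ≈⟨ *-distribˡ-∑ (nat (n !)) (allFin p) _ ⟨
      nat (n !) * ∑[ x ← allFin p ] ∑[ b ← tuples p q n ] H (insertAt b k x)
        ≈⟨ *-congˡ (∑-tuples-insertAt n k H) ⟩
      nat (n !) * ∑ (tuples p q (suc n)) H
        ∎

module KudlaMillson {c ℓ} (R : CommutativeRing c ℓ) (p n : ℕ) (m : KM.Mono R p (suc n)) (S : Vec Bool (p ℕ.* suc n)) where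
  open CommutativeRing R renaming (Carrier to K) hiding (zero)
  open import Algebra.Properties.Ring ring using (-‿distribˡ-*; -‿distribʳ-*)
  open import Relation.Binary.Reasoning.Setoid setoid
  open KM R
  open Arithmetic R
  open Terms R p (suc n)
  open Expansions R p (suc n)
  open Coefficients R p (suc n) m S

  q : ℕ
  q = suc n

  -- ± z_{p+j} z_b times the wedge of the ω_{b_i,·} over the other columns: both sides reduce to these.
  cofactorₜ : Fin q → Vec (Fin p) n → Term p q
  cofactorₜ j b = tm (sgn (toℕ j)) (yMono j ⊞ zProdMono b) (tabulate (λ i → combine (lookup b i) (punchIn j i)))

  Σcofactors : K
  Σcofactors = ∑[ j ← allFin q ] ∑[ b ← tuples p q n ] coeffₜ (cofactorₜ j b)

  ∑-ιw-diag : ∀ a (G : Fin p → Fin q → K × Word p q → K) →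
    ∑[ α ← allFin p ] ∑[ μ ← allFin q ] ∑ (ιw p q (combine α μ) (tabulate (diag a))) (G α μ)
      ≈ ∑[ j ← allFin q ] G (lookup a j) j (sgn (toℕ j) , tabulate (diag a ∘ punchIn j))
  ∑-ιw-diag a G = begin
    ∑[ α ← allFin p ] ∑[ μ ← allFin q ] ∑ (ιw p q (combine α μ) (tabulate (diag a))) (G α μ)
      ≈⟨ ∑-cong (allFin p) (λ α → ∑-cong (allFin q) (λ μ → ∑-ιw-tabulate n (diag a) (combine α μ) (G α μ))) ⟩
    ∑[ α ← allFin p ] ∑[ μ ← allFin q ] ∑[ j ← allFin q ] Z α μ j
      ≈⟨ ∑-cong (allFin p) (λ α → ∑-comm (allFin q) (allFin q) (Z α)) ⟩
    ∑[ α ← allFin p ] ∑[ j ← allFin q ] ∑[ μ ← allFin q ] Z α μ j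
      ≈⟨ ∑-comm (allFin p) (allFin q) _ ⟩
    ∑[ j ← allFin q ] ∑[ α ← allFin p ] ∑[ μ ← allFin q ] Z α μ j
      ≈⟨ ∑-cong (allFin q) (λ j → ∑-allFin-single p (lookup a j) _ (λ α α≢aj → ∑-zero (allFin q) (λ μ →
           Z-off j α μ (α≢aj ∘ ≡.sym ∘ Fin.combine-injectiveˡ (lookup a j) j α μ)))) ⟩
    ∑[ j ← allFin q ] ∑[ μ ← allFin q ] Z (lookup a j) μ j
      ≈⟨ ∑-cong (allFin q) (λ j → ∑-allFin-single q j _ (λ μ μ≢j →
           Z-off j (lookup a j) μ (μ≢j ∘ ≡.sym ∘ Fin.combine-injectiveʳ (lookup a j) j (lookup a j) μ))) ⟩
    ∑[ j ← allFin q ] Z (lookup a j) j j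
      ≈⟨ ∑-cong (allFin q) Z-diag ⟩
    ∑[ j ← allFin q ] G (lookup a j) j (sgn (toℕ j) , tabulate (diag a ∘ punchIn j))
      ∎
    where
    Z : Fin p → Fin q → Fin q → K
    Z α μ j = if ⌊ diag a j Fin.≟ combine α μ ⌋ then G α μ (sgn (toℕ j) , tabulate (diag a ∘ punchIn j)) else 0#

    Z-off : ∀ j α μ → diag a j ≢ combine α μ → Z α μ j ≈ 0#
    Z-off j α μ ne with diag a j Fin.≟ combine α μ
    ... | yes e = ⊥-elim (ne e)
    ... | no _  = refl

    Z-diag : ∀ j → Z (lookup a j) j j ≈ G (lookup a j) j (sgn (toℕ j) , tabulate (diag a ∘ punchIn j))
    Z-diag j with diag a j Fin.≟ diag a j
    ... | yes _ = refl
    ... | no ne = ⊥-elim (ne ≡.refl)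

  -- z_{p+j} ∂/∂z_{a_j} applied to A*_{a_j,p+j} of the a-th summand of φ_KM.
  contractionₜ : K → Vec (Fin p) q → Fin q → Term p q
  contractionₜ r a j = zμₜ j ⊗ ∂ₜ (lookup a j ↑ˡ q) (tm (coef (φₜ r a) * sgn (toℕ j)) (mono (φₜ r a)) (tabulate (diag a ∘ punchIn j)))

  ∑-h-φKM : ∀ κ → ∑ (h p q (φKM p q κ)) coeffₜ ≈ ∑[ a ← tuples p q q ] ∑[ j ← allFin q ] coeffₜ (contractionₜ (pow κ q) a j)
  ∑-h-φKM κ = begin
    ∑ (h p q (φKM p q κ)) coeffₜ
      ≈⟨ ∑-h (φKM p q κ) coeffₜ ⟩
    ∑[ α ← allFin p ] ∑[ μ ← allFin q ] ∑ (A* p q α μ (φKM p q κ)) (F α μ)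
      ≈⟨ ∑-cong (allFin p) (λ α → ∑-cong (allFin q) (λ μ → trans (∑-A* α μ (φKM p q κ) (F α μ)) (∑-φKM κ (ιF α μ)))) ⟩
    ∑[ α ← allFin p ] ∑[ μ ← allFin q ] ∑[ a ← tuples p q q ] ιF α μ (φₜ r a)
      ≈⟨ ∑-cong (allFin p) (λ α → ∑-comm (allFin q) (tuples p q q) _) ⟩
    ∑[ α ← allFin p ] ∑[ a ← tuples p q q ] ∑[ μ ← allFin q ] ιF α μ (φₜ r a)
      ≈⟨ ∑-comm (allFin p) (tuples p q q) _ ⟩
    ∑[ a ← tuples p q q ] ∑[ α ← allFin p ] ∑[ μ ← allFin q ] ιF α μ (φₜ r a)
      ≈⟨ ∑-cong (tuples p q q) (λ a → trans
           (∑-cong (allFin p) (λ α → ∑-cong (allFin q) (λ μ →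
              reflexive (≡.cong (λ w → ∑ (ιw p q (combine α μ) w) (Fι α μ (φₜ r a))) (φₜ-word r a)))))
           (∑-ιw-diag a (λ α μ → Fι α μ (φₜ r a)))) ⟩
    ∑[ a ← tuples p q q ] ∑[ j ← allFin q ] coeffₜ (contractionₜ r a j)
      ∎
    where
    r = pow κ q
    F : Fin p → Fin q → Term p q → K
    F α μ = coeffₜ ∘ (zμₜ μ ⊗_) ∘ ∂ₜ (α ↑ˡ q)
    Fι : Fin p → Fin q → Term p q → K × Word p q → K
    Fι α μ t rw = F α μ (tm (coef t * proj₁ rw) (mono t) (proj₂ rw))
    ιF : Fin p → Fin q → Term p q → K
    ιF α μ t = ∑ (ιw p q (combine α μ) (word t)) (Fι α μ t)

  coeffₜ-contraction-insertAt : ∀ r j x (b : Vec (Fin p) n) →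
    coeffₜ (contractionₜ r (insertAt b j x) j) ≈ (r * nat (suc (lookup (zProdMono b) (x ↑ˡ q)))) * coeffₜ (cofactorₜ j b)
  coeffₜ-contraction-insertAt r j x b = begin
    coeffₜ (contractionₜ r a j)
      ≡⟨ ≡.cong coeffₜ contraction≡ ⟩
    coeffₜ (zμₜ j ⊗ tm ((cΦ * s) * N) (zProdMono b) w₀)
      ≈⟨ coeffₜ-∝ {zμₜ j ⊗ tm ((cΦ * s) * N) (zProdMono b) w₀} {cofactorₜ j b} (cΦ * N) ≡.refl ≡.refl
           (solve 4 (λ c σ ν w → (id ⊕ ((c ⊕ σ) ⊕ ν)) ⊕ w ⊜ (c ⊕ ν) ⊕ (σ ⊕ w)) refl cΦ s N (sgnW p q w₀)) ⟩
    (cΦ * N) * coeffₜ (cofactorₜ j b)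
      ≈⟨ *-congʳ (*-congʳ (φₜ-coef r a)) ⟩
    (r * N) * coeffₜ (cofactorₜ j b)
      ∎
    where
    open *-Solver using (solve; _⊕_; _⊜_; id)
    a = insertAt b j x
    cΦ = coef (φₜ r a)
    s = sgn (toℕ j)
    N = nat (suc (lookup (zProdMono b) (x ↑ˡ q)))
    w₀ = tabulate (λ i → combine (lookup b i) (punchIn j i))

    contraction≡ : contractionₜ r a j ≡ zμₜ j ⊗ tm ((cΦ * s) * N) (zProdMono b) w₀
    contraction≡ = ≡.trans
      (≡.cong₂ (λ y v → zμₜ j ⊗ ∂ₜ (y ↑ˡ q) (tm (cΦ * s) v (tabulate (diag a ∘ punchIn j))))
               (Vec.insertAt-lookup b j x) (≡.trans (φₜ-mono r a) (zProdMono-insertAt b j x)))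
      (≡.trans (≡.cong (λ w → zμₜ j ⊗ ∂ₜ (x ↑ˡ q) (tm (cΦ * s) (xMono x ⊞ zProdMono b) w))
                       (List.tabulate-cong (λ i → ≡.cong (λ y → combine y (punchIn j i)) (Vec.insertAt-punchIn b j x i))))
               (≡.cong (zμₜ j ⊗_) (∂ₜ-xMono x (cΦ * s) (zProdMono b) w₀)))

  coeff-h-φKM : ∀ κ → ∑ (h p q (φKM p q κ)) coeffₜ ≈ (pow κ q * nat (p ℕ.+ n)) * Σcofactors
  coeff-h-φKM κ = begin
    ∑ (h p q (φKM p q κ)) coeffₜ
      ≈⟨ ∑-h-φKM κ ⟩
    ∑[ a ← tuples p q q ] ∑[ j ← allFin q ] coeffₜ (contractionₜ r a j)
      ≈⟨ ∑-comm (tuples p q q) (allFin q) _ ⟩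
    ∑[ j ← allFin q ] ∑[ a ← tuples p q q ] coeffₜ (contractionₜ r a j)
      ≈⟨ ∑-cong (allFin q) (λ j → ∑-tuples-insertAt n j (λ a → coeffₜ (contractionₜ r a j))) ⟨
    ∑[ j ← allFin q ] ∑[ x ← allFin p ] ∑[ b ← tuples p q n ] coeffₜ (contractionₜ r (insertAt b j x) j)
      ≈⟨ ∑-cong (allFin q) (λ j → ∑-cong (allFin p) (λ x → ∑-cong (tuples p q n) (coeffₜ-contraction-insertAt r j x))) ⟩
    ∑[ j ← allFin q ] ∑[ x ← allFin p ] ∑[ b ← tuples p q n ] ((r * N x b) * coeffₜ (cofactorₜ j b))
      ≈⟨ ∑-cong (allFin q) (λ j → ∑-comm (allFin p) (tuples p q n) _) ⟩
    ∑[ j ← allFin q ] ∑[ b ← tuples p q n ] ∑[ x ← allFin p ] ((r * N x b) * coeffₜ (cofactorₜ j b))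
      ≈⟨ ∑-cong (allFin q) (λ j → ∑-cong (tuples p q n) (λ b → ∑-degree b (coeffₜ (cofactorₜ j b)))) ⟩
    ∑[ j ← allFin q ] ∑[ b ← tuples p q n ] ((r * nat (p ℕ.+ n)) * coeffₜ (cofactorₜ j b))
      ≈⟨ ∑-cong (allFin q) (λ j → *-distribˡ-∑ (r * nat (p ℕ.+ n)) (tuples p q n) _) ⟨
    ∑[ j ← allFin q ] ((r * nat (p ℕ.+ n)) * ∑[ b ← tuples p q n ] coeffₜ (cofactorₜ j b))
      ≈⟨ *-distribˡ-∑ (r * nat (p ℕ.+ n)) (allFin q) _ ⟨
    (r * nat (p ℕ.+ n)) * Σcofactors
      ∎
    where
    r = pow κ q
    N : Fin p → Vec (Fin p) n → K
    N x b = nat (suc (lookup (zProdMono b) (x ↑ˡ q)))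
    ∑-degree : ∀ b z → ∑[ x ← allFin p ] ((r * N x b) * z) ≈ (r * nat (p ℕ.+ n)) * z
    ∑-degree b z = begin
      ∑[ x ← allFin p ] ((r * N x b) * z)  ≈⟨ *-distribʳ-∑ z (allFin p) _ ⟨
      ∑[ x ← allFin p ] (r * N x b) * z   ≈⟨ *-congʳ (*-distribˡ-∑ r (allFin p) _) ⟨
      (r * ∑[ x ← allFin p ] N x b) * z   ≈⟨ *-congʳ (*-congˡ (∑-suc-lookup-zProdMono b)) ⟩
      (r * nat (p ℕ.+ n)) * z             ∎

  -- The matrix of rhsKM: det (suc n) only applies it to zero and suc _, so the two agree definitionally.
  firstRowMatrix : Vec (Fin p) n → Fin q → Fin q → Elem p q
  firstRowMatrix b zero    j = zμ p q j
  firstRowMatrix b (suc i) j = ω p q (lookup b i) j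

  signedZμₜ : Fin q → Term p q
  signedZμₜ j = tm (sgn (toℕ j)) (yMono j) []

  coeffₜ-pull-zμ : ∀ (b : Vec (Fin p) n) j d →
    coeffₜ (zProdₜ b ⊗ scaleₜ (sgn (toℕ j)) (zμₜ j ⊗ d)) ≈ coeffₜ ((signedZμₜ j ⊗ zProdₜ b) ⊗ d)
  coeffₜ-pull-zμ b j d = coeffₜ-≗ {lhs} {rhs} coef≈ mono≡ ≡.refl
    where
    lhs = zProdₜ b ⊗ scaleₜ (sgn (toℕ j)) (zμₜ j ⊗ d)
    rhs = (signedZμₜ j ⊗ zProdₜ b) ⊗ d

    coef≈ : coef lhs ≈ coef rhs
    coef≈ = solve 3 (λ z σ e → z ⊕ (σ ⊕ (id ⊕ e)) ⊜ (σ ⊕ z) ⊕ e) refl (coef (zProdₜ b)) (sgn (toℕ j)) (coef d)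
      where open *-Solver

    mono≡ : mono lhs ≡ mono rhs
    mono≡ = solve 3 (λ z y w → z ⊕ (y ⊕ w) ⊜ (y ⊕ z) ⊕ w) ≡.refl (mono (zProdₜ b)) (yMono j) (mono d)
      where open ⊞-Solver

  coeffₜ-cofactor : ∀ (b : Vec (Fin p) n) j →
    coeffₜ ((signedZμₜ j ⊗ zProdₜ b) ⊗ ωProdₜ b (punchIn j)) ≈ coeffₜ (cofactorₜ j b)
  coeffₜ-cofactor b j = coeffₜ-≗ {(signedZμₜ j ⊗ zProdₜ b) ⊗ ωProdₜ b (punchIn j)} {cofactorₜ j b}
    (trans (*-identityʳ _) (trans (*-congˡ (zProdₜ-coef b)) (*-identityʳ _)))
    (≡.trans (Vec.zipWith-identityʳ ℕ.+-identityʳ _) (≡.cong (yMono j ⊞_) (zProdₜ-mono b)))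
    (≡.cong (_++ _) (zProdₜ-word b))

  ∑-firstRow-det : ∀ b →
    ∑ (_·_ p q (prodL p q (map (λ i → zα p q (lookup b i)) (allFin n))) (det p q q (firstRowMatrix b))) coeffₜ
      ≈ ∑[ j ← allFin q ] ∑ (detω n b (punchIn j)) (λ d → coeffₜ ((signedZμₜ j ⊗ zProdₜ b) ⊗ d))
  ∑-firstRow-det b = begin
    ∑ (_·_ p q (prodL p q (map (λ i → zα p q (lookup b i)) (allFin n))) (det p q q (firstRowMatrix b))) coeffₜ
      ≡⟨ ≡.cong (λ f → ∑ (_·_ p q f (det p q q (firstRowMatrix b))) coeffₜ) (prodL-map-[] (λ i → zαₜ (lookup b i)) (allFin n)) ⟩
    ∑ (_·_ p q [ zProdₜ b ] (det p q q (firstRowMatrix b))) coeffₜ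
      ≈⟨ ∑-·-[] (zProdₜ b) (det p q q (firstRowMatrix b)) coeffₜ ⟩
    ∑ (det p q q (firstRowMatrix b)) (coeffₜ ∘ (zProdₜ b ⊗_))
      ≈⟨ ∑-det-suc n (firstRowMatrix b) _ ⟩
    ∑[ j ← allFin q ] ∑ (_·_ p q [ zμₜ j ] (detω n b (punchIn j))) (coeffₜ ∘ (zProdₜ b ⊗_) ∘ scaleₜ (sgn (toℕ j)))
      ≈⟨ ∑-cong (allFin q) (λ j → trans (∑-·-[] (zμₜ j) (detω n b (punchIn j)) _)
                                         (∑-cong (detω n b (punchIn j)) (coeffₜ-pull-zμ b j))) ⟩
    ∑[ j ← allFin q ] ∑ (detω n b (punchIn j)) (λ d → coeffₜ ((signedZμₜ j ⊗ zProdₜ b) ⊗ d))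
      ∎

  coeff-rhsKM : ∀ κ v → coeff p q (rhsKM p q κ v) m S ≈ - ((pow κ q * (v * nat (n !))) * Σcofactors)
  coeff-rhsKM κ v = begin
    coeff p q (rhsKM p q κ v) m S
      ≈⟨ coeff-scale (pow κ q * - v) (concat (map summand (tuples p q n))) ⟩
    (pow κ q * - v) * ∑ (concat (map summand (tuples p q n))) coeffₜ
      ≈⟨ *-congˡ (trans (∑-concat (map summand (tuples p q n)) coeffₜ) (reflexive (∑-map summand (tuples p q n) _))) ⟩
    (pow κ q * - v) * ∑[ b ← tuples p q n ] ∑ (summand b) coeffₜ
      ≈⟨ *-congˡ (∑-cong (tuples p q n) ∑-firstRow-det) ⟩
    (pow κ q * - v) * ∑[ b ← tuples p q n ] ∑[ j ← allFin q ] ∑ (detω n b (punchIn j)) (λ d → coeffₜ ((signedZμₜ j ⊗ zProdₜ b) ⊗ d))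
      ≈⟨ *-congˡ (∑-comm (tuples p q n) (allFin q) _) ⟩
    (pow κ q * - v) * ∑[ j ← allFin q ] ∑[ b ← tuples p q n ] ∑ (detω n b (punchIn j)) (λ d → coeffₜ ((signedZμₜ j ⊗ zProdₜ b) ⊗ d))
      ≈⟨ *-congˡ (∑-cong (allFin q) (λ j → ∑-tuples-detω n (signedZμₜ j) (punchIn j))) ⟩
    (pow κ q * - v) * ∑[ j ← allFin q ] (nat (n !) * ∑[ b ← tuples p q n ] coeffₜ ((signedZμₜ j ⊗ zProdₜ b) ⊗ ωProdₜ b (punchIn j)))
      ≈⟨ *-congˡ (∑-cong (allFin q) (λ j → *-congˡ (∑-cong (tuples p q n) (λ b → coeffₜ-cofactor b j)))) ⟩
    (pow κ q * - v) * ∑[ j ← allFin q ] (nat (n !) * ∑[ b ← tuples p q n ] coeffₜ (cofactorₜ j b))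
      ≈⟨ *-congˡ (*-distribˡ-∑ (nat (n !)) (allFin q) _) ⟨
    (pow κ q * - v) * (nat (n !) * Σcofactors)
      ≈⟨ *-congʳ (-‿distribʳ-* (pow κ q) v) ⟨
    - (pow κ q * v) * (nat (n !) * Σcofactors)
      ≈⟨ -‿distribˡ-* _ _ ⟨
    - ((pow κ q * v) * (nat (n !) * Σcofactors))
      ≈⟨ -‿cong (solve 4 (λ r w N Z → (r ⊕ w) ⊕ (N ⊕ Z) ⊜ (r ⊕ (w ⊕ N)) ⊕ Z) refl (pow κ q) v (nat (n !)) Σcofactors) ⟩
    - ((pow κ q * (v * nat (n !))) * Σcofactors)
      ∎
    where
    open *-Solver using (solve; _⊕_; _⊜_)
    summand : Vec (Fin p) n → Elem p q
    summand b = _·_ p q (prodL p q (map (λ i → zα p q (lookup b i)) (allFin n))) (det p q q (firstRowMatrix b))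

  coeff-ψKM : ∀ κ u → coeff p q (ψKM p q κ u) m S ≈ - ((pow κ q * (u * nat (p ℕ.+ n))) * Σcofactors)
  coeff-ψKM κ u = begin
    coeff p q (ψKM p q κ u) m S
      ≈⟨ coeff-scale (- u) (h p q (φKM p q κ)) ⟩
    - u * ∑ (h p q (φKM p q κ)) coeffₜ
      ≈⟨ *-congˡ (coeff-h-φKM κ) ⟩
    - u * ((pow κ q * nat (p ℕ.+ n)) * Σcofactors)
      ≈⟨ -‿distribˡ-* _ _ ⟨
    - (u * ((pow κ q * nat (p ℕ.+ n)) * Σcofactors))
      ≈⟨ -‿cong (solve 4 (λ w r N Z → w ⊕ ((r ⊕ N) ⊕ Z) ⊜ (r ⊕ (w ⊕ N)) ⊕ Z) refl u (pow κ q) (nat (p ℕ.+ n)) Σcofactors) ⟩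
    - ((pow κ q * (u * nat (p ℕ.+ n))) * Σcofactors)
      ∎
    where open *-Solver using (solve; _⊕_; _⊜_)

  normalisations-agree : ∀ u v → u * nat (2 ℕ.* (p ℕ.+ q ℕ.∸ 1)) ≈ 1# → v * nat (2 ℕ.* (q ℕ.∸ 1) !) ≈ 1# →
    u * nat (p ℕ.+ n) ≈ v * nat (n !)
  normalisations-agree u v u-normalises v-normalises = inverse-unique
    (halve-inverse u (p ℕ.+ n) (≡.subst (λ k → u * nat (2 ℕ.* k) ≈ 1#) (≡.cong (ℕ._∸ 1) (ℕ.+-suc p n)) u-normalises))
    (halve-inverse v (n !) v-normalises)

open import Data.Nat using (_≤_; _+_; _*_; _∸_)

lemma4p1 : ∀ {c ℓ} (R : CommutativeRing c ℓ) →
    (p q : ℕ) → 1 ≤ p → 1 ≤ q →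
    (κ u v : CommutativeRing.Carrier R) →
    CommutativeRing._≈_ R (CommutativeRing._*_ R u (KM.nat R (2 * (p + q ∸ 1)))) (CommutativeRing.1# R) →
    CommutativeRing._≈_ R (CommutativeRing._*_ R v (KM.nat R (2 * (q ∸ 1) !))) (CommutativeRing.1# R) →
    KM._≈ᴱ_ R p q (KM.ψKM R p q κ u) (KM.rhsKM R p q κ v)
-- 1 ≤ p is not needed; 1 ≤ q excludes q = 0, where rhsKM is junk (the empty sum).
lemma4p1 R p zero    _ ()
lemma4p1 R p (suc n) _ _ κ u v u-normalises v-normalises m S =
  trans (coeff-ψKM κ u) (trans (-‿cong (*-congʳ (*-congˡ (normalisations-agree u v u-normalises v-normalises))))
                               (sym (coeff-rhsKM κ v)))
  where
  open CommutativeRing R using (trans; sym; -‿cong; *-congʳ; *-congˡ)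
  open KudlaMillson R p n m S
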